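{- Let $D=(V+r,A)$ be a $2$-root-connected rooted digraph, let $\alpha\ge 0$ be an integer, and let $D'=(V+r,A')$ be a root-connected rooted digraph obtained from $D$ by deleting $\alpha$ arcs of $A$. Then for every $v\in V+r$, there are at most $\alpha$ arcs which are critical in $D'$ and whose tail is $v$.
   Context: Digraphs are loopless but may have parallel arcs. A rooted digraph $D=(V+r,A)$ has vertex set $V\cup\{r\}$ and a root $r$ of in-degree $0$. For $X\subseteq V$, $d^-_D(X)$ is the number of arcs of $D$ with head in $X$ and tail outside $X$. $D$ is $k$-root-connected if $d^-_D(X)\ge k$ for all nonempty $X\subseteq V$; root-connected means $1$-root-connected. In a root-connected rooted digraph $D$, an arc $a$ is critical if $D-a$ is not root-connected. -}

module Defs where

open import Data.Nat using (ℕ; suc; _≤_)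
open import Data.Fin using (Fin; zero)
open import Data.Fin.Subset using (Subset; _∈_; _∉_; Nonempty)
open import Data.Fin.Subset.Properties using (_∈?_)
open import Data.Product using (_×_; proj₁; proj₂)
open import Data.List using (List; length; filter; removeAt)
open import Data.List.Relation.Unary.All using (All)
open import Relation.Nullary using (¬_; _×-dec_; ¬?)
open import Relation.Binary.PropositionalEquality using (_≢_)

-- Vertex set V + r is Fin (suc n); the root r is  zero , V is the rest.
-- An arc is a pair (tail , head).  Parallel arcs = repeated list entries.
Arc : ℕ → Set
Arc m = Fin m × Fin m

tail head : ∀ {m} → Arc m → Fin m
tail = proj₁
head = proj₂

IsRootedDigraph : ∀ {n} → List (Arc (suc n)) → Set
IsRootedDigraph A = All (λ a → tail a ≢ head a) A × All (λ a → head a ≢ zero) A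

indeg : ∀ {m} → List (Arc m) → Subset m → ℕ
indeg A X = length (filter (λ a → (head a ∈? X) ×-dec ¬? (tail a ∈? X)) A)

RootConnected : ℕ → ∀ {n} → List (Arc (suc n)) → Set
RootConnected k {n} A =
  (X : Subset (suc n)) → zero ∉ X → Nonempty X → k ≤ indeg A X

Critical : ∀ {n} (A : List (Arc (suc n))) → Fin (length A) → Set
Critical A i = ¬ RootConnected 1 (removeAt A i)

-- An arc a critical in D' comes with a nonempty root-free set X_a that a is the
-- only arc of D' to enter; as D is 2-root-connected, some deleted arc enters X_a.
-- For two critical arcs with common tail v the sets are disjoint: an arc entering
-- X_a ∩ X_b has its tail outside X_a (say), so it is a; then its tail v lies
-- outside X_b, so it is b too. Hence a deleted arc entering X_a, chosen for each
-- critical arc a with tail v, determines a.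
module Submission where

open import Defs
open import Data.Nat using (ℕ; suc; _≤_; _+_; s≤s)
open import Data.Nat.Properties using (≤-refl; n≤1+n; +-monoˡ-≤; +-cancelˡ-≤; n≢0⇒n>0; _≟_; module ≤-Reasoning)
open import Data.Fin using (Fin; zero; suc)
open import Data.Fin.Properties using (injective⇒≤)
open import Data.Fin.Subset using (Subset; _∈_; _∉_; Nonempty; _∩_)
open import Data.Fin.Subset.Properties using (_∈?_; nonempty?; anySubset?; x∈p∩q⁺; x∈p∩q⁻)
open import Data.Product using (_×_; _,_; proj₁; proj₂; ∃)
open import Data.List using (List; _∷_; length; _++_; lookup; filter; removeAt)
open import Data.List.Properties using (filter-++; length-++; filter-none)
open import Data.List.Relation.Unary.All using (All)
open import Data.List.Relation.Unary.AllPairs using (_∷_)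
import Data.List.Relation.Unary.All as All
open import Data.List.Relation.Unary.All.Properties using (¬Any⇒All¬)
open import Data.List.Relation.Unary.Any using (any?; index)
open import Data.List.Relation.Unary.Any.Properties using (lookup-index)
open import Data.List.Relation.Unary.Unique.Propositional using (Unique)
open import Data.List.Membership.Propositional.Properties using (∈-lookup)
open import Data.List.Relation.Binary.Permutation.Propositional using (_↭_)
open import Data.List.Relation.Binary.Permutation.Propositional.Properties using (filter-↭; ↭-length)
open import Function.Base using (_∘_)
open import Function.Definitions using (Injective)
open import Relation.Nullary using (¬_; yes; no; _×-dec_; ¬?; contradiction)
open import Relation.Unary using (Decidable)
open import Relation.Binary.PropositionalEquality using (_≡_; refl; sym; trans; cong; subst)

module _ {A : Set} {P : A → Set} (P? : Decidable P) where

  count : List A → ℕ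
  count xs = length (filter P? xs)

  count-++ : ∀ xs ys → count (xs ++ ys) ≡ count xs + count ys
  count-++ xs ys = trans (cong length (filter-++ P? xs ys)) (length-++ (filter P? xs))

  count-↭ : ∀ {xs ys} → xs ↭ ys → count xs ≡ count ys
  count-↭ xs↭ys = ↭-length (filter-↭ P? xs↭ys)

  count>0⇒∃lookup : ∀ xs → 1 ≤ count xs → ∃ λ p → P (lookup xs p)
  count>0⇒∃lookup xs 1≤count with any? P? xs
  ... | yes any = index any , lookup-index any
  ... | no ¬any with () ← subst (λ ys → 1 ≤ length ys) (filter-none P? (¬Any⇒All¬ xs ¬any)) 1≤count

  count≤suc-count-removeAt : ∀ xs i → count xs ≤ suc (count (removeAt xs i))
  count≤suc-count-removeAt (x ∷ xs) zero with P? x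
  ... | yes _ = ≤-refl
  ... | no _  = n≤1+n _
  count≤suc-count-removeAt (x ∷ xs) (suc i) with P? x
  ... | yes _ = s≤s (count≤suc-count-removeAt xs i)
  ... | no _  = count≤suc-count-removeAt xs i

  count≡0⇒¬lookup : ∀ xs p → count xs ≡ 0 → ¬ P (lookup xs p)
  count≡0⇒¬lookup (x ∷ xs) p c px with P? x
  count≡0⇒¬lookup (x ∷ xs) p       () px | yes _
  count≡0⇒¬lookup (x ∷ xs) zero    c  px | no ¬px = ¬px px
  count≡0⇒¬lookup (x ∷ xs) (suc p) c  px | no _   = count≡0⇒¬lookup xs p c px

  count-removeAt≡0⇒≡ : ∀ xs i p → count (removeAt xs i) ≡ 0 → P (lookup xs p) → p ≡ i
  count-removeAt≡0⇒≡ (x ∷ xs) zero    zero    c px = refl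
  count-removeAt≡0⇒≡ (x ∷ xs) zero    (suc p) c px = contradiction px (count≡0⇒¬lookup xs p c)
  count-removeAt≡0⇒≡ (x ∷ xs) (suc i) p       c px with P? x
  count-removeAt≡0⇒≡ (x ∷ xs) (suc i) p       () px | yes _
  count-removeAt≡0⇒≡ (x ∷ xs) (suc i) zero    c  px | no ¬px = contradiction px ¬px
  count-removeAt≡0⇒≡ (x ∷ xs) (suc i) (suc p) c  px | no _   = cong suc (count-removeAt≡0⇒≡ xs i p c px)

Unique-lookup-injective : ∀ {A : Set} {xs : List A} → Unique xs → Injective _≡_ _≡_ (lookup xs)
Unique-lookup-injective {xs = x ∷ xs} (x∉xs ∷ uniq) {zero}  {zero}  _  = refl
Unique-lookup-injective {xs = x ∷ xs} (x∉xs ∷ uniq) {zero}  {suc k} eq = contradiction eq (All.lookup x∉xs (∈-lookup k))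
Unique-lookup-injective {xs = x ∷ xs} (x∉xs ∷ uniq) {suc k} {zero}  eq = contradiction (sym eq) (All.lookup x∉xs (∈-lookup k))
Unique-lookup-injective {xs = x ∷ xs} (x∉xs ∷ uniq) {suc k} {suc l} eq = cong suc (Unique-lookup-injective uniq eq)

module _ {n : ℕ} where

  Enters : Subset (suc n) → Arc (suc n) → Set
  Enters X a = head a ∈ X × tail a ∉ X

  enters? : (X : Subset (suc n)) → Decidable (Enters X)
  enters? X a = (head a ∈? X) ×-dec ¬? (tail a ∈? X)

  record CriticalSet (L : List (Arc (suc n))) (i : Fin (length L)) : Set where
    field
      set              : Subset (suc n)
      root∉            : zero ∉ set
      nonempty         : Nonempty set
      indeg-removeAt≡0 : indeg (removeAt L i) set ≡ 0

  open CriticalSet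

  critical⇒CriticalSet : ∀ L i → Critical L i → CriticalSet L i
  critical⇒CriticalSet L i crit
    with anySubset? (λ X → ¬? (zero ∈? X) ×-dec nonempty? X ×-dec (indeg (removeAt L i) X ≟ 0))
  ... | yes (X , root∉ , nonempty , d≡0) = record
    { set = X ; root∉ = root∉ ; nonempty = nonempty ; indeg-removeAt≡0 = d≡0 }
  ... | no ∄X = contradiction (λ X root∉ nonempty → n≢0⇒n>0 λ d≡0 → ∄X (X , root∉ , nonempty , d≡0)) crit

  module _ {L : List (Arc (suc n))} {i : Fin (length L)} (S : CriticalSet L i) where

    enters-CriticalSet⇒≡ : ∀ p → Enters (set S) (lookup L p) → p ≡ i
    enters-CriticalSet⇒≡ p = count-removeAt≡0⇒≡ (enters? (set S)) L i p (indeg-removeAt≡0 S)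

    indeg-CriticalSet≤1 : indeg L (set S) ≤ 1
    indeg-CriticalSet≤1 = subst (λ d → indeg L (set S) ≤ suc d) (indeg-removeAt≡0 S)
      (count≤suc-count-removeAt (enters? (set S)) L i)

    criticalArc-enters : RootConnected 1 L → Enters (set S) (lookup L i)
    criticalArc-enters rc
      with p , enters ← count>0⇒∃lookup (enters? (set S)) L (rc (set S) (root∉ S) (nonempty S))
      = subst (λ q → Enters (set S) (lookup L q)) (enters-CriticalSet⇒≡ p enters) enters

  enters-both⇒≡ : ∀ {L} → RootConnected 1 L → ∀ {i j} (Si : CriticalSet L i) (Sj : CriticalSet L j) →
                  tail (lookup L i) ≡ tail (lookup L j) →
                  ∀ p → head (lookup L p) ∈ set Si → head (lookup L p) ∈ set Sj →
                  tail (lookup L p) ∉ set Si → i ≡ j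
  enters-both⇒≡ {L} rc {i} Si Sj tails≡ p h∈Si h∈Sj t∉Si =
    trans (sym p≡i) (enters-CriticalSet⇒≡ Sj p (h∈Sj , t∉Sj))
    where
    p≡i : p ≡ i
    p≡i = enters-CriticalSet⇒≡ Si p (h∈Si , t∉Si)
    t∉Sj : tail (lookup L p) ∉ set Sj
    t∉Sj = subst (_∉ set Sj) (sym (trans (cong (λ q → tail (lookup L q)) p≡i) tails≡))
      (proj₂ (criticalArc-enters Sj rc))

  CriticalSets-meet⇒≡ : ∀ {L} → RootConnected 1 L → ∀ {i j} (Si : CriticalSet L i) (Sj : CriticalSet L j) →
                        tail (lookup L i) ≡ tail (lookup L j) →
                        ∀ {x} → x ∈ set Si → x ∈ set Sj → i ≡ j
  CriticalSets-meet⇒≡ {L} rc Si Sj tails≡ {x} x∈Si x∈Sj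
    with p , h∈∩ , t∉∩ ← count>0⇒∃lookup (enters? (set Si ∩ set Sj)) L
           (rc (set Si ∩ set Sj) (root∉ Si ∘ proj₁ ∘ x∈p∩q⁻ _ _) (x , x∈p∩q⁺ (x∈Si , x∈Sj)))
    with h∈Si , h∈Sj ← x∈p∩q⁻ _ _ h∈∩ | tail (lookup L p) ∈? set Si
  ... | no t∉Si  = enters-both⇒≡ rc Si Sj tails≡ p h∈Si h∈Sj t∉Si
  ... | yes t∈Si = sym (enters-both⇒≡ rc Sj Si (sym tails≡) p h∈Sj h∈Si
                         (λ t∈Sj → t∉∩ (x∈p∩q⁺ (t∈Si , t∈Sj))))

  deletedArc-enters : ∀ {A L Del : List (Arc (suc n))} → RootConnected 2 A → A ↭ L ++ Del →
                      ∀ {i} (S : CriticalSet L i) → ∃ λ p → Enters (set S) (lookup Del p)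
  deletedArc-enters {A} {L} {Del} rc2 A↭L++Del S =
    count>0⇒∃lookup (enters? X) Del (+-cancelˡ-≤ 1 _ _ 2≤1+indeg)
    where
    X = set S
    2≤1+indeg : 2 ≤ 1 + indeg Del X
    2≤1+indeg = begin
      2                         ≤⟨ rc2 X (root∉ S) (nonempty S) ⟩
      indeg A X                 ≡⟨ count-↭ (enters? X) A↭L++Del ⟩
      indeg (L ++ Del) X        ≡⟨ count-++ (enters? X) L Del ⟩
      indeg L X + indeg Del X   ≤⟨ +-monoˡ-≤ (indeg Del X) (indeg-CriticalSet≤1 S) ⟩
      1 + indeg Del X           ∎
      where open ≤-Reasoning

open CriticalSet using (set)

lemma1 : ∀ {n} (A A' Del : List (Arc (suc n))) (α : ℕ) →
    IsRootedDigraph A → RootConnected 2 A →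
    A ↭ A' ++ Del → length Del ≡ α →
    RootConnected 1 A' →
    (v : Fin (suc n)) (I : List (Fin (length A'))) → Unique I →
    All (λ i → Critical A' i × tail (lookup A' i) ≡ v) I →
    length I ≤ α
lemma1 A A' Del α _ rc2 A↭A'++Del refl rc1 v I unique criticalAt-v =
  injective⇒≤ {f = deleted} deleted-injective
  where
  S : ∀ k → CriticalSet A' (lookup I k)
  S k = critical⇒CriticalSet A' _ (proj₁ (All.lookup criticalAt-v (∈-lookup k)))

  tail≡v : ∀ k → tail (lookup A' (lookup I k)) ≡ v
  tail≡v k = proj₂ (All.lookup criticalAt-v (∈-lookup k))

  deleted : Fin (length I) → Fin (length Del)
  deleted k = proj₁ (deletedArc-enters rc2 A↭A'++Del (S k))

  head-deleted∈S : ∀ k → head (lookup Del (deleted k)) ∈ set (S k)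
  head-deleted∈S k = proj₁ (proj₂ (deletedArc-enters rc2 A↭A'++Del (S k)))

  deleted-injective : Injective _≡_ _≡_ deleted
  deleted-injective {k} {l} same = Unique-lookup-injective unique
    (CriticalSets-meet⇒≡ rc1 (S k) (S l) (trans (tail≡v k) (sym (tail≡v l)))
      (head-deleted∈S k) (subst (λ p → head (lookup Del p) ∈ set (S l)) (sym same) (head-deleted∈S l)))
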